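{- Let $\mathbf{D}$ be a dagger kernel category with a $\mathrm{KSub}$-simple $\mathrm{KSub}$-generator $I$. Then for every object $X$, beneath every nonzero element of $\mathrm{KSub}(X)$ lies a nonzero element of the form $x\colon I\to X$ (a kernel). Hence $\mathrm{KSub}(X)$ is atomic, and its atoms are the nonzero kernels $x\colon I\to X$.
   Context: A dagger category is a category with a contravariant functor $\dagger$ that is the identity on objects with $f^{\dagger\dagger}=f$; $f$ is a dagger mono if $f^\dagger\circ f=\mathrm{id}$. A dagger kernel category is a dagger category with a zero object $0$ in which every morphism $f$ has a kernel (universal $k$ with $f\circ k=0$) that can be chosen to be a dagger mono. $\mathrm{KSub}(X)$ is the poset of kernels with codomain $X$ modulo isomorphism of domains, with $m\le n$ iff $m=n\circ\varphi$ for some $\varphi$; it has least element $0$ and greatest element $1=\mathrm{id}_X$. An object $I$ is $\mathrm{KSub}$-simple if $\mathrm{KSub}(I)=\{0,1\}$. An object $I$ is a $\mathrm{KSub}$-generator if for all parallel $f,g\colon X\to Y$, $f\circ x=g\circ x$ for all kernels $x\colon I\to X$ implies $f=g$. An atom of a poset with least element $0$ is an element $a>0$ such that $0\le z<a$ implies $z=0$; the poset is atomic if below every nonzero element there is an atom. -}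

module Defs where

open import Level using (Level; _⊔_; suc)
open import Data.Product using (Σ; Σ-syntax; _×_; _,_)
open import Data.Sum using (_⊎_)
open import Relation.Nullary using (¬_)
open import Relation.Binary.PropositionalEquality using (_≡_)

record DaggerKernelCategory (o ℓ : Level) : Set (suc (o ⊔ ℓ)) where
  infixr 9 _∘_
  infix 10 _†
  field
    Obj : Set o
    Hom : Obj → Obj → Set ℓ
    id  : ∀ {X} → Hom X X
    _∘_ : ∀ {X Y Z} → Hom Y Z → Hom X Y → Hom X Z
    assoc    : ∀ {W X Y Z} (h : Hom Y Z) (g : Hom X Y) (f : Hom W X) →
               (h ∘ g) ∘ f ≡ h ∘ (g ∘ f)
    identityˡ : ∀ {X Y} (f : Hom X Y) → id ∘ f ≡ f
    identityʳ : ∀ {X Y} (f : Hom X Y) → f ∘ id ≡ f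
    _†     : ∀ {X Y} → Hom X Y → Hom Y X
    †-id   : ∀ {X} → (id {X}) † ≡ id
    †-∘    : ∀ {X Y Z} (g : Hom Y Z) (f : Hom X Y) → (g ∘ f) † ≡ (f †) ∘ (g †)
    †-inv  : ∀ {X Y} (f : Hom X Y) → (f †) † ≡ f
    𝟘        : Obj
    ¡        : ∀ {X} → Hom 𝟘 X
    ¡-unique : ∀ {X} (f : Hom 𝟘 X) → f ≡ ¡
    !        : ∀ {X} → Hom X 𝟘
    !-unique : ∀ {X} (f : Hom X 𝟘) → f ≡ !

  zeroMor : ∀ {X Y} → Hom X Y
  zeroMor = ¡ ∘ !

  IsKernel : ∀ {K X Y} → Hom X Y → Hom K X → Set (o ⊔ ℓ)
  IsKernel {K} {X} {Y} f k =
    (f ∘ k ≡ zeroMor) ×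
    (∀ {Z} (g : Hom Z X) → f ∘ g ≡ zeroMor →
       Σ[ h ∈ Hom Z K ] ((k ∘ h ≡ g) × (∀ (h' : Hom Z K) → k ∘ h' ≡ g → h' ≡ h)))

  field
    kernel : ∀ {X Y} (f : Hom X Y) →
             Σ[ K ∈ Obj ] Σ[ k ∈ Hom K X ] (IsKernel f k × ((k †) ∘ k ≡ id))

  -- m is a kernel (of some morphism): an element (representative) of KSub(X)
  IsKernelMor : ∀ {K X} → Hom K X → Set (o ⊔ ℓ)
  IsKernelMor {K} {X} m = Σ[ Y ∈ Obj ] Σ[ f ∈ Hom X Y ] IsKernel f m

  _≤K_ : ∀ {M N X} → Hom M X → Hom N X → Set ℓ
  _≤K_ {M} {N} m n = Σ[ φ ∈ Hom M N ] (m ≡ n ∘ φ)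

  -- the least element 0 of KSub(X) is represented by ¡ : 0 → X;
  -- m represents 0 iff m ≤ 0 (since 0 ≤ m always)
  IsZeroSub : ∀ {M X} → Hom M X → Set ℓ
  IsZeroSub {X = X} m = m ≤K (¡ {X})

  IsAtom : ∀ {A X} → Hom A X → Set (o ⊔ ℓ)
  IsAtom {A} {X} a =
    IsKernelMor a × (¬ IsZeroSub a) ×
    (∀ {Z} (z : Hom Z X) → IsKernelMor z → z ≤K a → ¬ (a ≤K z) → IsZeroSub z)

  IsAtomicKSub : Obj → Set (o ⊔ ℓ)
  IsAtomicKSub X =
    ∀ {N} (n : Hom N X) → IsKernelMor n → ¬ IsZeroSub n →
      Σ[ A ∈ Obj ] Σ[ a ∈ Hom A X ] (IsAtom a × a ≤K n)

  IsKSubSimple : Obj → Set (o ⊔ ℓ)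
  IsKSubSimple I =
    ∀ {K} (k : Hom K I) → IsKernelMor k → IsZeroSub k ⊎ (id {I} ≤K k)

  IsKSubGenerator : Obj → Set (o ⊔ ℓ)
  IsKSubGenerator I =
    ∀ {X Y} (f g : Hom X Y) →
      (∀ (x : Hom I X) → IsKernelMor x → f ∘ x ≡ g ∘ x) → f ≡ g

module Submission where

-- Idea.  Let n be a nonzero kernel into X, say of f, and let k : K → X be
-- the chosen dagger-mono kernel of f; k and n represent the same subobject,
-- so K is not a zero object (id_K ≠ 0).  Since I is a KSub-generator, a
-- nonzero object receives a nonzero kernel y : I → K (otherwise id_K and 0
-- agree on all kernels out of I).  The composite k ∘ y is again a kernel
-- (composites of kernels along a dagger-mono kernel are kernels, via the
-- dagger cokernel) and it is nonzero and below n.  Conversely, whenever a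
-- kernel z lies below a kernel x : I → X, the factor φ with z = x ∘ φ is a
-- kernel into I, so by KSub-simplicity it is 0 or 1: hence nonzero kernels
-- out of I are atoms, and every atom is equivalent to one of them.
--
-- Classical logic enters only through double negation elimination.

open import Defs
open import Level using (_⊔_; Lift; lift; lower)
open import Data.Product using (Σ; Σ-syntax; _×_; _,_; proj₁; proj₂)
open import Data.Sum using (inj₁; inj₂)
open import Data.Empty using (⊥-elim)
open import Relation.Nullary using (¬_)
open import Axiom.ExcludedMiddle using (ExcludedMiddle)
open import Axiom.DoubleNegationElimination
  using (DoubleNegationElimination; em⇒dne)
open import Relation.Binary.PropositionalEquality
  using (_≡_; refl; sym; trans; cong; cong₂; module ≡-Reasoning)

dne-lower : ∀ {a b} → DoubleNegationElimination (a ⊔ b) →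
            DoubleNegationElimination b
dne-lower {a} dne ¬¬p = lower (dne {Lift a _} (λ ¬lp → ¬¬p (λ p → ¬lp (lift p))))

module KernelTheory {o ℓ} (D : DaggerKernelCategory o ℓ) where
  open DaggerKernelCategory D
  open ≡-Reasoning

  zero-∘ : ∀ {X Y Z} (f : Hom X Y) → zeroMor {Y} {Z} ∘ f ≡ zeroMor
  zero-∘ f = trans (assoc ¡ ! f) (cong (¡ ∘_) (!-unique (! ∘ f)))

  ∘-zero : ∀ {X Y Z} (f : Hom Y Z) → f ∘ zeroMor {X} {Y} ≡ zeroMor
  ∘-zero f = trans (sym (assoc f ¡ !)) (cong (_∘ !) (¡-unique (f ∘ ¡)))

  zero-† : ∀ {X Y} → (zeroMor {X} {Y}) † ≡ zeroMor
  zero-† = trans (†-∘ ¡ !) (cong₂ _∘_ (¡-unique (! †)) (!-unique (¡ †)))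

  zeroSub⇒≡zero : ∀ {M X} {m : Hom M X} → IsZeroSub m → m ≡ zeroMor
  zeroSub⇒≡zero (φ , m≡¡φ) = trans m≡¡φ (cong (¡ ∘_) (!-unique φ))

  ≡zero⇒zeroSub : ∀ {M X} {m : Hom M X} → m ≡ zeroMor → IsZeroSub m
  ≡zero⇒zeroSub m≡0 = ! , m≡0

  ≤K-trans : ∀ {L M N X} {l : Hom L X} {m : Hom M X} {n : Hom N X} →
             l ≤K m → m ≤K n → l ≤K n
  ≤K-trans {l = l} {m} {n} (φ , l≡mφ) (ψ , m≡nψ) =
    ψ ∘ φ , (begin
      l           ≡⟨ l≡mφ ⟩
      m ∘ φ       ≡⟨ cong (_∘ φ) m≡nψ ⟩
      (n ∘ ψ) ∘ φ ≡⟨ assoc n ψ φ ⟩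
      n ∘ (ψ ∘ φ) ∎)

  kernel-factor : ∀ {K X Y Z} {f : Hom X Y} {k : Hom K X} → IsKernel f k →
                  (g : Hom Z X) → f ∘ g ≡ zeroMor → g ≤K k
  kernel-factor (_ , univ) g fg≡0 =
    let (h , kh≡g , _) = univ g fg≡0 in h , sym kh≡g

  Mono : ∀ {A X} → Hom A X → Set (o ⊔ ℓ)
  Mono {A} m = ∀ {W} (a b : Hom W A) → m ∘ a ≡ m ∘ b → a ≡ b

  mono-∘ : ∀ {A B C} {k : Hom B C} {y : Hom A B} → Mono k → Mono y → Mono (k ∘ y)
  mono-∘ {k = k} {y} mk my a b e =
    my a b (mk (y ∘ a) (y ∘ b) (trans (sym (assoc k y a)) (trans e (assoc k y b))))

  mono-factor : ∀ {A B C} {x : Hom B C} {φ : Hom A B} → Mono (x ∘ φ) → Mono φ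
  mono-factor {x = x} {φ} m a b e =
    m a b (trans (assoc x φ a) (trans (cong (x ∘_) e) (sym (assoc x φ b))))

  -- Kernels are monic, by uniqueness of factorisations.
  kernel-mono : ∀ {K X Y} {f : Hom X Y} {k : Hom K X} → IsKernel f k → Mono k
  kernel-mono {f = f} {k} (fk≡0 , univ) a b e =
    let (_ , _ , unique) = univ (k ∘ a) fka≡0
    in trans (unique a refl) (sym (unique b (sym e)))
    where
    fka≡0 : f ∘ (k ∘ a) ≡ zeroMor
    fka≡0 = trans (sym (assoc f k a)) (trans (cong (_∘ a) fk≡0) (zero-∘ a))

  -- A mono m is a kernel of c as soon as c kills m and everything killed by
  -- c factors through m (uniqueness of factorisations comes from monicity).
  kernel-intro : ∀ {M X Y} {c : Hom X Y} {m : Hom M X} → c ∘ m ≡ zeroMor →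
                 Mono m → (∀ {Z} (z : Hom Z X) → c ∘ z ≡ zeroMor → z ≤K m) →
                 IsKernel c m
  kernel-intro {m = m} cm≡0 mono factor = cm≡0 , univ
    where
    univ : ∀ {Z} (z : Hom Z _) → _ ≡ zeroMor →
           Σ[ h ∈ Hom Z _ ] ((m ∘ h ≡ z) × (∀ h' → m ∘ h' ≡ z → h' ≡ h))
    univ z cz≡0 =
      let (h , z≡mh) = factor z cz≡0
      in h , sym z≡mh , (λ h' mh'≡z → mono h' h (trans mh'≡z z≡mh))

  kernel-reflects-zero : ∀ {K X Y W} {f : Hom X Y} {k : Hom K X} → IsKernel f k →
                         (y : Hom W K) → k ∘ y ≡ zeroMor → y ≡ zeroMor
  kernel-reflects-zero kk y ky≡0 =
    kernel-mono kk y zeroMor (trans ky≡0 (sym (∘-zero _)))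

  cok : ∀ {A X} (m : Hom A X) → Hom X (proj₁ (kernel (m †)))
  cok m = proj₁ (proj₂ (kernel (m †))) †

  cok-kills : ∀ {A X} (m : Hom A X) → cok m ∘ m ≡ zeroMor
  cok-kills m = begin
    kl † ∘ m        ≡⟨ cong (kl † ∘_) (sym (†-inv m)) ⟩
    kl † ∘ (m †) †  ≡⟨ sym (†-∘ (m †) kl) ⟩
    (m † ∘ kl) †    ≡⟨ cong _† (proj₁ (proj₁ (proj₂ (proj₂ (kernel (m †)))))) ⟩
    zeroMor †       ≡⟨ zero-† ⟩
    zeroMor         ∎
    where kl = proj₁ (proj₂ (kernel (m †)))

  -- Whatever kills m also kills everything killed by cok m (dually: f
  -- factors through cok m).
  cok-universal : ∀ {A X Y W} (m : Hom A X) (f : Hom X Y) (z : Hom W X) →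
                  f ∘ m ≡ zeroMor → cok m ∘ z ≡ zeroMor → f ∘ z ≡ zeroMor
  cok-universal m f z fm≡0 cz≡0 = begin
    f ∘ z               ≡⟨ cong (_∘ z) f≡u†c ⟩
    (u † ∘ cok m) ∘ z   ≡⟨ assoc (u †) (cok m) z ⟩
    u † ∘ (cok m ∘ z)   ≡⟨ cong (u † ∘_) cz≡0 ⟩
    u † ∘ zeroMor       ≡⟨ ∘-zero (u †) ⟩
    zeroMor             ∎
    where
    kl = proj₁ (proj₂ (kernel (m †)))
    m†f†≡0 = trans (sym (†-∘ f m)) (trans (cong _† fm≡0) zero-†)
    factorisation = kernel-factor (proj₁ (proj₂ (proj₂ (kernel (m †))))) (f †) m†f†≡0
    u = proj₁ factorisation
    f≡u†c : f ≡ u † ∘ cok m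
    f≡u†c = begin
      f              ≡⟨ sym (†-inv f) ⟩
      (f †) †        ≡⟨ cong _† (proj₂ factorisation) ⟩
      (kl ∘ u) †     ≡⟨ †-∘ kl u ⟩
      u † ∘ cok m    ∎

  kernel-∘ : ∀ {K X Y Z J} {f : Hom X Y} {k : Hom K X} {g : Hom K Z} {y : Hom J K} →
             IsKernel f k → k † ∘ k ≡ id → IsKernel g y → IsKernel (cok (k ∘ y)) (k ∘ y)
  kernel-∘ {K} {X} {f = f} {k} {g} {y} kk k†k≡id ky =
    kernel-intro (cok-kills (k ∘ y)) (mono-∘ (kernel-mono kk) (kernel-mono ky)) factor
    where
    fky≡0 : f ∘ (k ∘ y) ≡ zeroMor
    fky≡0 = trans (sym (assoc f k y)) (trans (cong (_∘ y) (proj₁ kk)) (zero-∘ y))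
    k†-retracts : ∀ {W} (w : Hom W K) → k † ∘ (k ∘ w) ≡ w
    k†-retracts w = begin
      k † ∘ (k ∘ w)   ≡⟨ sym (assoc (k †) k w) ⟩
      (k † ∘ k) ∘ w   ≡⟨ cong (_∘ w) k†k≡id ⟩
      id ∘ w          ≡⟨ identityˡ w ⟩
      w               ∎
    gk†ky≡0 : (g ∘ k †) ∘ (k ∘ y) ≡ zeroMor
    gk†ky≡0 = trans (assoc g (k †) (k ∘ y)) (trans (cong (g ∘_) (k†-retracts y)) (proj₁ ky))
    -- z killed by cok (k ∘ y) is killed by f, so z = k ∘ w; then w is
    -- killed by g, so w = y ∘ h.
    factor : ∀ {W} (z : Hom W X) → cok (k ∘ y) ∘ z ≡ zeroMor → z ≤K (k ∘ y)
    factor z cz≡0 = h , (begin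
      z            ≡⟨ z≡kw ⟩
      k ∘ w        ≡⟨ cong (k ∘_) w≡yh ⟩
      k ∘ (y ∘ h)  ≡⟨ sym (assoc k y h) ⟩
      (k ∘ y) ∘ h  ∎)
      where
      z≤k = kernel-factor kk z (cok-universal (k ∘ y) f z fky≡0 cz≡0)
      w = proj₁ z≤k
      z≡kw = proj₂ z≤k
      gw≡0 : g ∘ w ≡ zeroMor
      gw≡0 = begin
        g ∘ w               ≡⟨ cong (g ∘_) (sym (k†-retracts w)) ⟩
        g ∘ (k † ∘ (k ∘ w)) ≡⟨ cong (λ t → g ∘ (k † ∘ t)) (sym z≡kw) ⟩
        g ∘ (k † ∘ z)       ≡⟨ sym (assoc g (k †) z) ⟩
        (g ∘ k †) ∘ z       ≡⟨ cok-universal (k ∘ y) (g ∘ k †) z gk†ky≡0 cz≡0 ⟩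
        zeroMor             ∎
      w≤y : w ≤K y
      w≤y = kernel-factor ky w gw≡0
      h = proj₁ w≤y
      w≡yh = proj₂ w≤y

  factor-kernel : ∀ {Z A X Y} {z : Hom Z X} {x : Hom A X} {h : Hom X Y} {φ : Hom Z A} →
                  Mono x → IsKernel h z → z ≡ x ∘ φ → IsKernel (h ∘ x) φ
  factor-kernel {z = z} {x} {h} {φ} mx kz z≡xφ =
    kernel-intro hxφ≡0 (mono-factor (λ a b e → kernel-mono kz a b (through-z e))) factor
    where
    through-z : ∀ {W} {a b : Hom W _} → (x ∘ φ) ∘ a ≡ (x ∘ φ) ∘ b → z ∘ a ≡ z ∘ b
    through-z {a = a} {b} e = trans (cong (_∘ a) z≡xφ) (trans e (cong (_∘ b) (sym z≡xφ)))
    hxφ≡0 : (h ∘ x) ∘ φ ≡ zeroMor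
    hxφ≡0 = trans (assoc h x φ) (trans (cong (h ∘_) (sym z≡xφ)) (proj₁ kz))
    factor : ∀ {W} (w : Hom W _) → (h ∘ x) ∘ w ≡ zeroMor → w ≤K φ
    factor w hxw≡0 = u , mx w (φ ∘ u) (begin
      x ∘ w         ≡⟨ xw≡zu ⟩
      z ∘ u         ≡⟨ cong (_∘ u) z≡xφ ⟩
      (x ∘ φ) ∘ u   ≡⟨ assoc x φ u ⟩
      x ∘ (φ ∘ u)   ∎)
      where
      xw≤z = kernel-factor kz (x ∘ w) (trans (sym (assoc h x w)) hxw≡0)
      u = proj₁ xw≤z
      xw≡zu = proj₂ xw≤z

  -- Over a KSub-simple I, every nonzero kernel x : I → X is an atom: a
  -- kernel z below x has a kernel comparison map into I, which is 0 or 1.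
  simple-point-atom : ∀ {I X} → IsKSubSimple I → (x : Hom I X) → IsKernelMor x →
                      ¬ IsZeroSub x → IsAtom x
  simple-point-atom {I} {X} simple x kx@(_ , _ , xker) x≢0 = kx , x≢0 , below
    where
    below : ∀ {Z} (z : Hom Z X) → IsKernelMor z → z ≤K x → ¬ (x ≤K z) → IsZeroSub z
    below z (_ , h , zker) (φ , z≡xφ) x≰z
      with simple φ (_ , h ∘ x , factor-kernel (kernel-mono xker) zker z≡xφ)
    ... | inj₁ φ≡0 = ≡zero⇒zeroSub (begin
          z            ≡⟨ z≡xφ ⟩
          x ∘ φ        ≡⟨ cong (x ∘_) (zeroSub⇒≡zero φ≡0) ⟩
          x ∘ zeroMor  ≡⟨ ∘-zero x ⟩
          zeroMor      ∎)
    ... | inj₂ (χ , id≡φχ) = ⊥-elim (x≰z (χ , (begin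
          x            ≡⟨ sym (identityʳ x) ⟩
          x ∘ id       ≡⟨ cong (x ∘_) id≡φχ ⟩
          x ∘ (φ ∘ χ)  ≡⟨ sym (assoc x φ χ) ⟩
          (x ∘ φ) ∘ χ  ≡⟨ cong (_∘ χ) (sym z≡xφ) ⟩
          z ∘ χ        ∎)))

  -- A KSub-generator detects zero objects: if every kernel I → K is zero,
  -- then id_K and 0 agree on all of them, so id_K = 0.
  generator-detects-zero : ∀ {I K} → IsKSubGenerator I →
                           (∀ (y : Hom I K) → IsKernelMor y → IsZeroSub y) →
                           id {K} ≡ zeroMor
  generator-detects-zero gen all-zero = gen id zeroMor agree
    where
    agree : ∀ y → IsKernelMor y → id ∘ y ≡ zeroMor ∘ y
    agree y ky = trans (identityˡ y) (trans (zeroSub⇒≡zero (all-zero y ky)) (sym (zero-∘ y)))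

  nonzero-point : DoubleNegationElimination (o ⊔ ℓ) → ∀ {I K X Y} → IsKSubGenerator I →
                  {f : Hom X Y} {k : Hom K X} → IsKernel f k → ¬ IsZeroSub k →
                  Σ[ y ∈ Hom I K ] (IsKernelMor y × ¬ IsZeroSub y)
  nonzero-point dne gen {k = k} kk k≢0 = dne λ no-point →
    k≢0 (≡zero⇒zeroSub (begin
      k            ≡⟨ sym (identityʳ k) ⟩
      k ∘ id       ≡⟨ cong (k ∘_) (generator-detects-zero gen (λ y ky →
                        dne-lower {o} dne (λ y≢0 → no-point (y , ky , y≢0)))) ⟩
      k ∘ zeroMor  ≡⟨ ∘-zero k ⟩
      zeroMor      ∎))

  -- Main step: below every nonzero kernel n : N → X lies a nonzero kernel
  -- x : I → X, namely k ∘ y for the dagger-mono kernel k equivalent to n.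
  point-below : DoubleNegationElimination (o ⊔ ℓ) → ∀ {I X} → IsKSubGenerator I →
                ∀ {N} (n : Hom N X) → IsKernelMor n → ¬ IsZeroSub n →
                Σ[ x ∈ Hom I X ] (IsKernelMor x × (¬ IsZeroSub x) × (x ≤K n))
  point-below dne gen n (_ , f , nker) n≢0 =
    k ∘ y , (_ , _ , kernel-∘ kker k†k≡id yker) , ky≢0 , ≤K-trans (y , refl) k≤n
    where
    k = proj₁ (proj₂ (kernel f))
    kker = proj₁ (proj₂ (proj₂ (kernel f)))
    k†k≡id = proj₂ (proj₂ (proj₂ (kernel f)))
    k≤n = kernel-factor nker k (proj₁ kker)
    n≤k = kernel-factor kker n (proj₁ nker)
    k≢0 : ¬ IsZeroSub k
    k≢0 k≤0 = n≢0 (≤K-trans n≤k k≤0)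
    point = nonzero-point dne gen kker k≢0
    y = proj₁ point
    yker = proj₂ (proj₂ (proj₁ (proj₂ point)))
    ky≢0 : ¬ IsZeroSub (k ∘ y)
    ky≢0 ky≤0 = proj₂ (proj₂ point)
      (≡zero⇒zeroSub (kernel-reflects-zero kker y (zeroSub⇒≡zero ky≤0)))

  -- Every atom a is equivalent to a nonzero kernel x : I → X: such an x lies
  -- below a, and x is not zero, so by atomicity a ≤K x.
  atom-is-point : DoubleNegationElimination (o ⊔ ℓ) → ∀ {I X} → IsKSubGenerator I →
                  ∀ {A} (a : Hom A X) → IsAtom a →
                  Σ[ x ∈ Hom I X ] (IsKernelMor x × (¬ IsZeroSub x) × (x ≤K a) × (a ≤K x))
  atom-is-point dne gen a (ka , a≢0 , minimal) =
    let (x , kx , x≢0 , x≤a) = point-below dne gen a ka a≢0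
    in x , kx , x≢0 , x≤a ,
       dne-lower {o} dne (λ a≰x → x≢0 (minimal x kx x≤a a≰x))

lemma8p5 : ∀ {o ℓ} → ExcludedMiddle (o ⊔ ℓ) →
    (D : DaggerKernelCategory o ℓ) → let open DaggerKernelCategory D in
    (I : Obj) → IsKSubSimple I → IsKSubGenerator I →
    ∀ (X : Obj) →
      (∀ {N} (n : Hom N X) → IsKernelMor n → ¬ IsZeroSub n →
        Σ[ x ∈ Hom I X ] (IsKernelMor x × (¬ IsZeroSub x) × (x ≤K n)))
      × IsAtomicKSub X
      × (∀ (x : Hom I X) → IsKernelMor x → ¬ IsZeroSub x → IsAtom x)
      × (∀ {A} (a : Hom A X) → IsAtom a →
          Σ[ x ∈ Hom I X ] (IsKernelMor x × (¬ IsZeroSub x) × (x ≤K a) × (a ≤K x)))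
lemma8p5 em D I simple gen X =
  point-below dne gen ,
  atomic ,
  simple-point-atom simple ,
  atom-is-point dne gen
  where
  open DaggerKernelCategory D
  open KernelTheory D
  dne = em⇒dne em
  atomic : IsAtomicKSub X
  atomic n kn n≢0 =
    let (x , kx , x≢0 , x≤n) = point-below dne gen n kn n≢0
    in I , x , simple-point-atom simple x kx x≢0 , x≤n
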